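{- Let $(\lambda,\mu)\in{\sf Kostka}_r^{\mathbb Z}$. Each column of the canonical matrix $A(\lambda,\mu)$ is one of the following: (1) a single consecutive run of $1$'s starting in the top row (all other entries $0$); (2) a single consecutive run of $1$'s not starting in the top row; or (3) two consecutive runs of $1$'s, one of which starts in the top row. Furthermore, the leftmost column is of type (1).
   Context: ${\sf Kostka}_r^{\mathbb Z}$ is the set of pairs $(\lambda,\mu)$ of partitions with at most $r$ nonzero parts, $|\lambda|=|\mu|$, $\sum_{i\le t}\lambda_i\ge\sum_{i\le t}\mu_i$ for all $t$. $\lambda'$ is the conjugate partition. Canonical (Ryser) matrix $A(\lambda,\mu)$: let $s=\lambda_1$. Start with the $r\times s$ $\{0,1\}$-matrix whose row $i$ has $\mu_i$ ones in columns $1,\ldots,\mu_i$. For $j=s,s-1,\ldots,1$ in turn: looking only at columns $1,\ldots,j$ of the current matrix, choose $\lambda'_j$ rows, taking rows with the largest number of $1$'s in columns $1,\ldots,j$ and breaking ties by preferring rows further south (larger row index); in each chosen row, move the rightmost $1$ among columns $1,\ldots,j$ to column $j$. Columns $j,\ldots,s$ are not changed afterwards. The final matrix is $A(\lambda,\mu)$. -}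

module Defs where

open import Data.Nat using (ℕ; zero; suc; _+_; _≤_; _<_; _<ᵇ_; _≡ᵇ_; _∸_)
open import Data.Bool using (Bool; true; false; if_then_else_; _∧_; _∨_)
open import Data.List using (List; []; _∷_; map; replicate; _++_; upTo)
open import Data.Vec using (Vec; toList)
open import Data.Maybe using (Maybe; just; nothing)
open import Data.Product using (Σ; _×_; ∃-syntax)
open import Data.Sum using (_⊎_)
open import Relation.Binary.PropositionalEquality using (_≡_)

Σ< : ℕ → (ℕ → ℕ) → ℕ
Σ< zero    f = 0
Σ< (suc n) f = Σ< n f + f n

-- i-th entry of a list (0-based), 0 out of range
nth : List ℕ → ℕ → ℕ
nth []       _       = 0
nth (x ∷ _)  zero    = x
nth (_ ∷ xs) (suc i) = nth xs i

-- a partition with at most r parts, stored as a length-r vector (padded by 0);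
-- part λ i is the (i+1)-st part λ_{i+1}
part : ∀ {r} → Vec ℕ r → ℕ → ℕ
part v i = nth (toList v) i

IsPartition : ∀ {r} → Vec ℕ r → Set
IsPartition v = ∀ i → part v (suc i) ≤ part v i

psum : ∀ {r} → Vec ℕ r → ℕ → ℕ
psum v t = Σ< t (part v)

Kostka : (r : ℕ) → Vec ℕ r → Vec ℕ r → Set
Kostka r lam mu =
  IsPartition lam × IsPartition mu × psum lam r ≡ psum mu r ×
  (∀ t → t ≤ r → psum mu t ≤ psum lam t)

-- conjugate partition: λ'_j = #{ i < r : λ_{i+1} ≥ j }   (j ≥ 1)
conj : (r : ℕ) → Vec ℕ r → ℕ → ℕ
conj r lam j = Σ< r (λ i → if j ∸ 1 <ᵇ part lam i then 1 else 0)

-- matrices: entry (i , c) = row i+1, column c+1 (0-based indices)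
Mat : Set
Mat = ℕ → ℕ → Bool

b2n : Bool → ℕ
b2n true  = 1
b2n false = 0

rowCount : Mat → ℕ → ℕ → ℕ
rowCount M i j = Σ< j (λ c → b2n (M i c))

rightmost : (ℕ → Bool) → ℕ → Maybe ℕ
rightmost f zero    = nothing
rightmost f (suc j) = if f j then just j else rightmost f j

beats : Mat → ℕ → ℕ → ℕ → Bool
beats M j k i =
  (rowCount M i j <ᵇ rowCount M k j) ∨
  ((rowCount M k j ≡ᵇ rowCount M i j) ∧ (i <ᵇ k))

rank : ℕ → Mat → ℕ → ℕ → ℕ
rank r M j i = Σ< r (λ k → b2n (beats M j k i))

chosen : (r : ℕ) → ℕ → Mat → ℕ → ℕ → Bool
chosen r n M j i = (i <ᵇ r) ∧ (rank r M j i <ᵇ n)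

moveRow : Mat → ℕ → ℕ → ℕ → Bool
moveRow M j i c with rightmost (M i) j
... | nothing = M i c
... | just p  = if c ≡ᵇ (j ∸ 1) then true else (if c ≡ᵇ p then false else M i c)

-- one step of the algorithm, for column j (1-based)
step : (r : ℕ) → Vec ℕ r → ℕ → Mat → Mat
step r lam j M i c =
  if chosen r (conj r lam j) M j i then moveRow M j i c else M i c

run : (r : ℕ) → Vec ℕ r → ℕ → Mat → Mat
run r lam zero    M = M
run r lam (suc j) M = run r lam j (step r lam (suc j) M)

initMat : (r : ℕ) → Vec ℕ r → Mat
initMat r mu i c = (i <ᵇ r) ∧ (c <ᵇ part mu i)

width : ∀ {r} → Vec ℕ r → ℕ
width lam = part lam 0

canonical : (r : ℕ) → Vec ℕ r → Vec ℕ r → Mat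
canonical r lam mu = run r lam (width lam) (initMat r mu)

column : ℕ → Mat → ℕ → List Bool
column r M c = map (λ i → M i c) (upTo r)

Type1 : List Bool → Set
Type1 col = ∃[ a ] ∃[ b ] (1 ≤ a × col ≡ replicate a true ++ replicate b false)

Type2 : List Bool → Set
Type2 col = ∃[ a ] ∃[ b ] ∃[ d ]
  (1 ≤ a × 1 ≤ b × col ≡ replicate a false ++ replicate b true ++ replicate d false)

Type3 : List Bool → Set
Type3 col = ∃[ a ] ∃[ b ] ∃[ d ] ∃[ e ]
  (1 ≤ a × 1 ≤ b × 1 ≤ d ×
   col ≡ replicate a true ++ replicate b false ++ replicate d true ++ replicate e false)

-- Before the step for column J, the first J columns of the matrix are left-justified and
-- their row lengths len form a partition dominated by λ cut off after column J (parts
-- min(λ_i, J)), with the same total.  Let n = λ'_J and let T be the n-th largest length.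
-- As len is weakly decreasing, the rows longer than T are rows 0, …, a - 1 and those of
-- length T are rows a, …, b - 1; the step chooses the former and the southmost n - a of the
-- latter, i.e. the rows in [0, a) ∪ [q, b).  So column J receives at most two runs of 1's,
-- the first starting in the top row.  Moving the rightmost 1 of each chosen row into column
-- J leaves columns 1, …, J - 1 left-justified, and the new lengths are dominated by λ cut
-- off after column J - 1: each partial sum t is checked by cases on the position of t
-- relative to a, n and b.  In column 1 all lengths are at most 1, so a = 0, and dominance
-- forces b ≤ n, so q = 0: a single run starting in the top row.

module Submission where

open import Defs
open import Data.Bool using (Bool; true; false; if_then_else_; _∧_; _∨_; not)
open import Data.Bool.Properties using (∧-zeroʳ; ∧-identityʳ; ∨-zeroʳ)
open import Data.Empty using (⊥-elim)
open import Data.List using (List; _∷_; map; replicate; _++_; upTo; applyUpTo)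
open import Data.List.Properties using (++-assoc; map-upTo; map-cong)
open import Data.Maybe using (just; nothing)
open import Data.Nat
open import Data.Nat.Properties
open import Data.Product using (_×_; _,_; proj₁; proj₂)
open import Data.Sum using (_⊎_; inj₁; inj₂)
open import Data.Vec using (Vec; []; _∷_)
open import Function using (_∘_)
open import Relation.Binary using (tri<; tri≈; tri>)
open import Relation.Binary.PropositionalEquality hiding (J)
open import Relation.Nullary using (yes; no)

open import Algebra.Properties.CommutativeSemigroup +-commutativeSemigroup using (interchange)

<⇒<ᵇ≡true : ∀ {m n} → m < n → (m <ᵇ n) ≡ true
<⇒<ᵇ≡true {zero}  {suc n} _       = refl
<⇒<ᵇ≡true {suc m} {suc n} (s≤s p) = <⇒<ᵇ≡true p

≥⇒<ᵇ≡false : ∀ {m n} → n ≤ m → (m <ᵇ n) ≡ false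
≥⇒<ᵇ≡false {m}     {zero}  _       = refl
≥⇒<ᵇ≡false {suc m} {suc n} (s≤s p) = ≥⇒<ᵇ≡false p

<ᵇ≡true⇒< : ∀ {m n} → (m <ᵇ n) ≡ true → m < n
<ᵇ≡true⇒< {zero}  {suc n} _ = z<s
<ᵇ≡true⇒< {suc m} {suc n} p = s<s (<ᵇ≡true⇒< p)

<ᵇ≡false⇒≥ : ∀ {m n} → (m <ᵇ n) ≡ false → n ≤ m
<ᵇ≡false⇒≥ {m}     {zero}  _ = z≤n
<ᵇ≡false⇒≥ {suc m} {suc n} p = s≤s (<ᵇ≡false⇒≥ p)

≡ᵇ-refl : ∀ m → (m ≡ᵇ m) ≡ true
≡ᵇ-refl zero    = refl
≡ᵇ-refl (suc m) = ≡ᵇ-refl m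

≢⇒≡ᵇ≡false : ∀ {m n} → m ≢ n → (m ≡ᵇ n) ≡ false
≢⇒≡ᵇ≡false {zero}  {zero}  p = ⊥-elim (p refl)
≢⇒≡ᵇ≡false {zero}  {suc n} p = refl
≢⇒≡ᵇ≡false {suc m} {zero}  p = refl
≢⇒≡ᵇ≡false {suc m} {suc n} p = ≢⇒≡ᵇ≡false (p ∘ cong suc)

true≢false : true ≢ false
true≢false ()

b2n≤1 : ∀ b → b2n b ≤ 1
b2n≤1 true  = ≤-refl
b2n≤1 false = z≤n

b2n-mono : ∀ x y → (x ≡ true → y ≡ true) → b2n x ≤ b2n y
b2n-mono false y h = z≤n
b2n-mono true  y h rewrite h refl = ≤-refl

<ᵇ-suc-minus-last : ∀ c y → (if c ≡ᵇ y then false else (c <ᵇ suc y)) ≡ (c <ᵇ y)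
<ᵇ-suc-minus-last zero    zero    = refl
<ᵇ-suc-minus-last zero    (suc y) = refl
<ᵇ-suc-minus-last (suc c) zero    = refl
<ᵇ-suc-minus-last (suc c) (suc y) = <ᵇ-suc-minus-last c y

if-then-1-else-0 : ∀ b → (if b then 1 else 0) ≡ b2n b
if-then-1-else-0 true  = refl
if-then-1-else-0 false = refl

Σ<-cong : ∀ n {f g} → (∀ i → i < n → f i ≡ g i) → Σ< n f ≡ Σ< n g
Σ<-cong zero    h = refl
Σ<-cong (suc n) h = cong₂ _+_ (Σ<-cong n (λ i p → h i (m<n⇒m<1+n p))) (h n ≤-refl)

Σ<-mono-≤ : ∀ n {f g} → (∀ i → i < n → f i ≤ g i) → Σ< n f ≤ Σ< n g
Σ<-mono-≤ zero    h = z≤n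
Σ<-mono-≤ (suc n) h = +-mono-≤ (Σ<-mono-≤ n (λ i p → h i (m<n⇒m<1+n p))) (h n ≤-refl)

Σ<-distrib-+ : ∀ n f g → Σ< n (λ i → f i + g i) ≡ Σ< n f + Σ< n g
Σ<-distrib-+ zero    f g = refl
Σ<-distrib-+ (suc n) f g rewrite Σ<-distrib-+ n f g = interchange (Σ< n f) (Σ< n g) (f n) (g n)

Σ<-+ : ∀ t d f → Σ< (t + d) f ≡ Σ< t f + Σ< d (λ i → f (t + i))
Σ<-+ t zero    f rewrite +-identityʳ t = sym (+-identityʳ _)
Σ<-+ t (suc d) f rewrite +-suc t d | Σ<-+ t d f =
  +-assoc (Σ< t f) (Σ< d (λ i → f (t + i))) (f (t + d))

Σ<-const : ∀ n c → Σ< n (λ _ → c) ≡ n * c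
Σ<-const zero    c = refl
Σ<-const (suc n) c rewrite Σ<-const n c = +-comm (n * c) c

Σ<-mono-length : ∀ t n f → t ≤ n → Σ< t f ≤ Σ< n f
Σ<-mono-length t n f t≤n with m≤n⇒∃[o]m+o≡n t≤n
... | d , refl rewrite Σ<-+ t d f = m≤m+n _ _

module _ (lo d : ℕ) (f : ℕ → ℕ) (c : ℕ) where

  private
    onSegment : ∀ {R : ℕ → ℕ → Set} → (∀ i → lo ≤ i → i < lo + d → R (f i) c) →
                ∀ i → i < d → R (f (lo + i)) c
    onSegment h i i<d = h (lo + i) (m≤m+n lo i) (+-monoʳ-< lo i<d)

  Σ<-extend-≡ : (∀ i → lo ≤ i → i < lo + d → f i ≡ c) → Σ< (lo + d) f ≡ Σ< lo f + d * c
  Σ<-extend-≡ h rewrite Σ<-+ lo d f =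
    cong (Σ< lo f +_) (trans (Σ<-cong d (onSegment {_≡_} h)) (Σ<-const d c))

  Σ<-extend-≤ : (∀ i → lo ≤ i → i < lo + d → f i ≤ c) → Σ< (lo + d) f ≤ Σ< lo f + d * c
  Σ<-extend-≤ h rewrite Σ<-+ lo d f | sym (Σ<-const d c) =
    +-monoʳ-≤ (Σ< lo f) (Σ<-mono-≤ d (onSegment {_≤_} h))

  Σ<-extend-≥ : (∀ i → lo ≤ i → i < lo + d → c ≤ f i) → Σ< lo f + d * c ≤ Σ< (lo + d) f
  Σ<-extend-≥ h rewrite Σ<-+ lo d f | sym (Σ<-const d c) =
    +-monoʳ-≤ (Σ< lo f) (Σ<-mono-≤ d (onSegment {λ x y → y ≤ x} h))

Σ<-vanishing-tail : ∀ t n f → t ≤ n → (∀ i → t ≤ i → f i ≡ 0) → Σ< n f ≡ Σ< t f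
Σ<-vanishing-tail t n f t≤n h with m≤n⇒∃[o]m+o≡n t≤n
... | d , refl = begin
  Σ< (t + d) f   ≡⟨ Σ<-extend-≡ t d f 0 (λ i t≤i _ → h i t≤i) ⟩
  Σ< t f + d * 0 ≡⟨ cong (Σ< t f +_) (*-zeroʳ d) ⟩
  Σ< t f + 0     ≡⟨ +-identityʳ _ ⟩
  Σ< t f         ∎
  where open ≡-Reasoning

count : ℕ → (ℕ → Bool) → ℕ
count n p = Σ< n (λ i → b2n (p i))

count≤ : ∀ n p → count n p ≤ n
count≤ n p = begin
  count n p          ≤⟨ Σ<-mono-≤ n (λ i _ → b2n≤1 (p i)) ⟩
  Σ< n (λ _ → 1)     ≡⟨ Σ<-const n 1 ⟩
  n * 1              ≡⟨ *-identityʳ n ⟩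
  n                  ∎
  where open ≤-Reasoning

count-all : ∀ n p → (∀ i → i < n → p i ≡ true) → count n p ≡ n
count-all n p h = trans (Σ<-cong n (λ i i<n → cong b2n (h i i<n)))
                        (trans (Σ<-const n 1) (*-identityʳ n))

count-<ᵇ : ∀ n k → k ≤ n → count n (_<ᵇ k) ≡ k
count-<ᵇ n k k≤n with m≤n⇒∃[o]m+o≡n k≤n
... | d , refl = begin
  Σ< (k + d) (λ i → b2n (i <ᵇ k))
    ≡⟨ Σ<-extend-≡ k d _ 0 (λ i k≤i _ → cong b2n (≥⇒<ᵇ≡false k≤i)) ⟩
  count k (_<ᵇ k) + d * 0
    ≡⟨ cong₂ _+_ (count-all k (_<ᵇ k) (λ i → <⇒<ᵇ≡true)) (*-zeroʳ d) ⟩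
  k + 0
    ≡⟨ +-identityʳ k ⟩
  k ∎
  where open ≡-Reasoning

count-interval : ∀ n lo hi → lo ≤ hi → hi ≤ n →
                 count n (λ k → not (k <ᵇ lo) ∧ (k <ᵇ hi)) ≡ hi ∸ lo
count-interval n lo hi lo≤hi hi≤n = sym (trans (cong (_∸ lo) hi≡) (m+n∸m≡n lo _))
  where
  split : ∀ k → k < n → b2n (k <ᵇ hi) ≡ b2n (k <ᵇ lo) + b2n (not (k <ᵇ lo) ∧ (k <ᵇ hi))
  split k _ with k <? lo
  ... | yes k<lo rewrite <⇒<ᵇ≡true k<lo | <⇒<ᵇ≡true (<-≤-trans k<lo lo≤hi) = refl
  ... | no  k≮lo rewrite ≥⇒<ᵇ≡false (≮⇒≥ k≮lo) = refl
  hi≡ : hi ≡ lo + count n (λ k → not (k <ᵇ lo) ∧ (k <ᵇ hi))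
  hi≡ = trans (sym (count-<ᵇ n hi hi≤n))
       (trans (Σ<-cong n split)
       (trans (Σ<-distrib-+ n _ _)
              (cong (_+ count n (λ k → not (k <ᵇ lo) ∧ (k <ᵇ hi)))
                    (count-<ᵇ n lo (≤-trans lo≤hi hi≤n)))))

DownClosed : ℕ → (ℕ → Bool) → Set
DownClosed r p = ∀ k → suc k < r → p (suc k) ≡ true → p k ≡ true

downClosed-below : ∀ {r p} → DownClosed r p → ∀ {i k} → i ≤ k → k < r → p k ≡ true → p i ≡ true
downClosed-below dc {i} {k} i≤k k<r pk with m≤n⇒m<n∨m≡n i≤k
... | inj₂ refl = pk
downClosed-below dc {i} {suc k} i≤k k<r pk | inj₁ i<k =
  downClosed-below dc (m<1+n⇒m≤n i<k) (<-trans (n<1+n k) k<r) (dc k k<r pk)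

downClosed⇒initial : ∀ r p → DownClosed r p → ∀ k → k < r → p k ≡ (k <ᵇ count r p)
downClosed⇒initial (suc r) p dc k k<1+r with p r in pr
... | true = trans (downClosed-below dc (m<1+n⇒m≤n k<1+r) ≤-refl pr)
                   (sym (<⇒<ᵇ≡true (subst (k <_) (sym all) k<1+r)))
  where
  all : count r p + 1 ≡ suc r
  all = trans (cong (_+ 1) (count-all r p (λ i i<r →
                downClosed-below dc (<⇒≤ i<r) ≤-refl pr)))
              (+-comm r 1)
... | false rewrite +-identityʳ (count r p) with m<1+n⇒m<n∨m≡n k<1+r
...   | inj₁ k<r  = downClosed⇒initial r p (λ i i<r → dc i (m<n⇒m<1+n i<r)) k k<r
...   | inj₂ refl = trans pr (sym (≥⇒<ᵇ≡false (count≤ k p)))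

holds⇒<count : ∀ {r p} → DownClosed r p → ∀ {k} → k < r → p k ≡ true → k < count r p
holds⇒<count {r} {p} dc {k} k<r pk = <ᵇ≡true⇒< (trans (sym (downClosed⇒initial r p dc k k<r)) pk)

<count⇒holds : ∀ {r p} → DownClosed r p → ∀ {k} → k < count r p → p k ≡ true
<count⇒holds {r} {p} dc {k} k<c =
  trans (downClosed⇒initial r p dc k (<-≤-trans k<c (count≤ r p))) (<⇒<ᵇ≡true k<c)

-- Columns consisting of at most two runs of 1's

ColumnType : List Bool → Set
ColumnType col = Type1 col ⊎ Type2 col ⊎ Type3 col

twoRuns : ℕ → ℕ → ℕ → ℕ → Bool
twoRuns p q q' i = (i <ᵇ p) ∨ (not (i <ᵇ q) ∧ (i <ᵇ q'))

module _ (p q q' : ℕ) {i : ℕ} where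

  twoRuns-first : i < p → twoRuns p q q' i ≡ true
  twoRuns-first i<p rewrite <⇒<ᵇ≡true i<p = refl

  twoRuns-gap : p ≤ i → i < q → twoRuns p q q' i ≡ false
  twoRuns-gap p≤i i<q rewrite ≥⇒<ᵇ≡false p≤i | <⇒<ᵇ≡true i<q = refl

  twoRuns-second : q ≤ i → i < q' → twoRuns p q q' i ≡ true
  twoRuns-second q≤i i<q' rewrite ≥⇒<ᵇ≡false q≤i | <⇒<ᵇ≡true i<q' = ∨-zeroʳ (i <ᵇ p)

  twoRuns-beyond : p ≤ q' → q' ≤ i → twoRuns p q q' i ≡ false
  twoRuns-beyond p≤q' q'≤i
    rewrite ≥⇒<ᵇ≡false (≤-trans p≤q' q'≤i) | ≥⇒<ᵇ≡false q'≤i = ∧-zeroʳ (not (i <ᵇ q))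

count-twoRuns : ∀ N {p q q'} → p ≤ q → q ≤ q' → q' ≤ N → count N (twoRuns p q q') ≡ p + (q' ∸ q)
count-twoRuns N {p} {q} {q'} p≤q q≤q' q'≤N = begin
  count N (twoRuns p q q')
    ≡⟨ Σ<-cong N split ⟩
  Σ< N (λ k → b2n (k <ᵇ p) + b2n (not (k <ᵇ q) ∧ (k <ᵇ q')))
    ≡⟨ Σ<-distrib-+ N _ _ ⟩
  count N (_<ᵇ p) + count N (λ k → not (k <ᵇ q) ∧ (k <ᵇ q'))
    ≡⟨ cong₂ _+_ (count-<ᵇ N p (≤-trans p≤q (≤-trans q≤q' q'≤N)))
                 (count-interval N q q' q≤q' q'≤N) ⟩
  p + (q' ∸ q) ∎
  where
  open ≡-Reasoning
  split : ∀ k → k < N → b2n (twoRuns p q q' k) ≡ b2n (k <ᵇ p) + b2n (not (k <ᵇ q) ∧ (k <ᵇ q'))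
  split k _ with k <? p
  ... | yes k<p rewrite <⇒<ᵇ≡true k<p | <⇒<ᵇ≡true (<-≤-trans k<p p≤q) = refl
  ... | no  k≮p rewrite ≥⇒<ᵇ≡false (≮⇒≥ k≮p) = refl

applyUpTo-cong : ∀ {A : Set} n {f g : ℕ → A} → (∀ i → i < n → f i ≡ g i) →
                 applyUpTo f n ≡ applyUpTo g n
applyUpTo-cong zero    h = refl
applyUpTo-cong (suc n) h = cong₂ _∷_ (h 0 z<s) (applyUpTo-cong n (λ i i<n → h (suc i) (s<s i<n)))

applyUpTo-const : ∀ {A : Set} n {f : ℕ → A} {x} → (∀ i → i < n → f i ≡ x) →
                  applyUpTo f n ≡ replicate n x
applyUpTo-const zero    h = refl
applyUpTo-const (suc n) h = cong₂ _∷_ (h 0 z<s) (applyUpTo-const n (λ i i<n → h (suc i) (s<s i<n)))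

applyUpTo-+ : ∀ {A : Set} (f : ℕ → A) m n →
              applyUpTo f (m + n) ≡ applyUpTo f m ++ applyUpTo (λ i → f (m + i)) n
applyUpTo-+ f zero    n = refl
applyUpTo-+ f (suc m) n = cong (f 0 ∷_) (applyUpTo-+ (f ∘ suc) m n)

replicate-+ : ∀ {A : Set} m n (x : A) → replicate m x ++ replicate n x ≡ replicate (m + n) x
replicate-+ zero    n x = refl
replicate-+ (suc m) n x = cong (x ∷_) (replicate-+ m n x)

applyUpTo-twoRuns : ∀ p d₁ d₂ d₃ →
  applyUpTo (twoRuns p (p + d₁) (p + d₁ + d₂)) (p + d₁ + d₂ + d₃) ≡
  replicate p true ++ replicate d₁ false ++ replicate d₂ true ++ replicate d₃ false
applyUpTo-twoRuns p d₁ d₂ d₃ = begin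
  applyUpTo g (p + d₁ + d₂ + d₃)
    ≡⟨ applyUpTo-+ g (p + d₁ + d₂) d₃ ⟩
  applyUpTo g (p + d₁ + d₂) ++ R₃
    ≡⟨ cong (_++ R₃) (applyUpTo-+ g (p + d₁) d₂) ⟩
  (applyUpTo g (p + d₁) ++ R₂) ++ R₃
    ≡⟨ cong (λ xs → (xs ++ R₂) ++ R₃) (applyUpTo-+ g p d₁) ⟩
  ((R₀ ++ R₁) ++ R₂) ++ R₃
    ≡⟨ trans (++-assoc (R₀ ++ R₁) R₂ R₃) (++-assoc R₀ R₁ (R₂ ++ R₃)) ⟩
  R₀ ++ R₁ ++ R₂ ++ R₃
    ≡⟨ cong₂ _++_ run₀ (cong₂ _++_ run₁ (cong₂ _++_ run₂ run₃)) ⟩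
  replicate p true ++ replicate d₁ false ++ replicate d₂ true ++ replicate d₃ false ∎
  where
  open ≡-Reasoning
  q = p + d₁
  q' = p + d₁ + d₂
  g = twoRuns p q q'
  R₀ = applyUpTo g p
  R₁ = applyUpTo (λ i → g (p + i)) d₁
  R₂ = applyUpTo (λ i → g (p + d₁ + i)) d₂
  R₃ = applyUpTo (λ i → g (p + d₁ + d₂ + i)) d₃
  run₀ : R₀ ≡ replicate p true
  run₀ = applyUpTo-const p (λ i → twoRuns-first p q q')
  run₁ : R₁ ≡ replicate d₁ false
  run₁ = applyUpTo-const d₁ (λ i i<d₁ → twoRuns-gap p q q' (m≤m+n p i) (+-monoʳ-< p i<d₁))
  run₂ : R₂ ≡ replicate d₂ true
  run₂ = applyUpTo-const d₂ (λ i i<d₂ →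
    twoRuns-second p q q' (m≤m+n (p + d₁) i) (+-monoʳ-< (p + d₁) i<d₂))
  run₃ : R₃ ≡ replicate d₃ false
  run₃ = applyUpTo-const d₃ (λ i _ →
    twoRuns-beyond p q q' (≤-trans (m≤m+n p d₁) (m≤m+n (p + d₁) d₂)) (m≤m+n (p + d₁ + d₂) i))

runs-columnType : ∀ p d₁ d₂ d₃ → 0 < d₂ →
  ColumnType (replicate p true ++ replicate d₁ false ++ replicate d₂ true ++ replicate d₃ false)
runs-columnType zero    zero     d₂ d₃ 0<d₂ = inj₁ (d₂ , d₃ , 0<d₂ , refl)
runs-columnType zero    (suc d₁) d₂ d₃ 0<d₂ = inj₂ (inj₁ (suc d₁ , d₂ , d₃ , z<s , 0<d₂ , refl))
runs-columnType (suc p) zero     d₂ d₃ 0<d₂ = inj₁ (suc p + d₂ , d₃ , z<s , merged)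
  where
  merged : replicate (suc p) true ++ replicate d₂ true ++ replicate d₃ false ≡
           replicate (suc p + d₂) true ++ replicate d₃ false
  merged = trans (sym (++-assoc (replicate (suc p) true) (replicate d₂ true) _))
                 (cong (_++ replicate d₃ false) (replicate-+ (suc p) d₂ true))
runs-columnType (suc p) (suc d₁) d₂ d₃ 0<d₂ =
  inj₂ (inj₂ (suc p , suc d₁ , d₂ , d₃ , z<s , z<s , 0<d₂ , refl))

column-twoRuns : ∀ r (f : ℕ → Bool) {p q q'} → p ≤ q → q < q' → q' ≤ r →
                 (∀ i → i < r → f i ≡ twoRuns p q q' i) → ColumnType (map f (upTo r))
column-twoRuns r f {p} p≤q q<q' q'≤r h
  with m≤n⇒∃[o]m+o≡n p≤q | m≤n⇒∃[o]m+o≡n q<q' | m≤n⇒∃[o]m+o≡n q'≤r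
... | d₁ , refl | d₂ , refl | d₃ , refl =
  subst ColumnType (sym column≡) (runs-columnType p d₁ (suc d₂) d₃ z<s)
  where
  open ≡-Reasoning
  q' = p + d₁ + suc d₂
  q'≡ : suc (p + d₁) + d₂ ≡ q'
  q'≡ = sym (+-suc (p + d₁) d₂)
  column≡ : map f (upTo (suc (p + d₁) + d₂ + d₃)) ≡
            replicate p true ++ replicate d₁ false ++ replicate (suc d₂) true ++ replicate d₃ false
  column≡ = begin
    map f (upTo (suc (p + d₁) + d₂ + d₃))
      ≡⟨ map-upTo f _ ⟩
    applyUpTo f (suc (p + d₁) + d₂ + d₃)
      ≡⟨ applyUpTo-cong _ h ⟩
    applyUpTo (twoRuns p (p + d₁) (suc (p + d₁) + d₂)) (suc (p + d₁) + d₂ + d₃)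
      ≡⟨ cong (λ x → applyUpTo (twoRuns p (p + d₁) x) (x + d₃)) q'≡ ⟩
    applyUpTo (twoRuns p (p + d₁) q') (q' + d₃)
      ≡⟨ applyUpTo-twoRuns p d₁ (suc d₂) d₃ ⟩
    replicate p true ++ replicate d₁ false ++ replicate (suc d₂) true ++ replicate d₃ false ∎

column-initialRun : ∀ r (f : ℕ → Bool) {q'} → 0 < q' → q' ≤ r →
                    (∀ i → i < r → f i ≡ twoRuns 0 0 q' i) → Type1 (map f (upTo r))
column-initialRun r f {q'} 0<q' q'≤r h with m≤n⇒∃[o]m+o≡n q'≤r
... | d , refl rewrite map-upTo f (q' + d) | applyUpTo-cong (q' + d) h
                     | applyUpTo-twoRuns 0 0 q' d = q' , d , 0<q' , refl

-- The steps of the algorithm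

rightmost-< : ∀ f j {p} → rightmost f j ≡ just p → p < j
rightmost-< f (suc j) e with f j
rightmost-< f (suc j) refl | true  = ≤-refl
...                        | false = m<n⇒m<1+n (rightmost-< f j e)

rightmost-leftJustified : ∀ (f : ℕ → Bool) j y → y < j → (∀ c → c < j → f c ≡ (c <ᵇ suc y)) →
                          rightmost f j ≡ just y
rightmost-leftJustified f (suc j) y y<1+j h with m<1+n⇒m<n∨m≡n y<1+j
... | inj₂ refl rewrite h j ≤-refl | <⇒<ᵇ≡true (n<1+n j) = refl
... | inj₁ y<j  rewrite h j ≤-refl | ≥⇒<ᵇ≡false y<j =
  rightmost-leftJustified f j y y<j (λ c c<j → h c (m<n⇒m<1+n c<j))

moveRow-just : ∀ M J i c {p} → rightmost (M i) J ≡ just p →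
  moveRow M J i c ≡ (if c ≡ᵇ (J ∸ 1) then true else (if c ≡ᵇ p then false else M i c))
moveRow-just M J i c e rewrite e = refl

moveRow-fixes-right : ∀ M J i c → J ≤ c → moveRow M J i c ≡ M i c
moveRow-fixes-right M zero    i c _ = refl
moveRow-fixes-right M (suc J) i c J<c with rightmost (M i) (suc J) in e
... | nothing = refl
... | just p
  rewrite ≢⇒≡ᵇ≡false (>⇒≢ J<c)
        | ≢⇒≡ᵇ≡false (>⇒≢ (<-≤-trans (rightmost-< (M i) (suc J) e) J<c)) = refl

step-fixes-right : ∀ r lam J M i c → J ≤ c → step r lam J M i c ≡ M i c
step-fixes-right r lam J M i c J≤c with chosen r (conj r lam J) M J i
... | true  = moveRow-fixes-right M J i c J≤c
... | false = refl

run-fixes-right : ∀ r lam j M i c → j ≤ c → run r lam j M i c ≡ M i c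
run-fixes-right r lam zero    M i c _   = refl
run-fixes-right r lam (suc j) M i c j<c =
  trans (run-fixes-right r lam j (step r lam (suc j) M) i c (<⇒≤ j<c))
        (step-fixes-right r lam (suc j) M i c j<c)

antitone : ∀ (f : ℕ → ℕ) → (∀ i → f (suc i) ≤ f i) → ∀ {i k} → i ≤ k → f k ≤ f i
antitone f step {i} {k} i≤k with m≤n⇒m<n∨m≡n i≤k
... | inj₂ refl = ≤-refl
antitone f step {i} {suc k} _ | inj₁ i<1+k = ≤-trans (step k) (antitone f step (m<1+n⇒m≤n i<1+k))

part-beyond : ∀ {r} (v : Vec ℕ r) i → r ≤ i → part v i ≡ 0
part-beyond []       i       _       = refl
part-beyond (x ∷ v) (suc i) (s≤s p) = part-beyond v i p

locate : ∀ p q q' i → i < p ⊎ (p ≤ i × i < q) ⊎ (q ≤ i × i < q') ⊎ q' ≤ i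
locate p q q' i with i <? p | i <? q | i <? q'
... | yes i<p | _       | _        = inj₁ i<p
... | no  i≮p | yes i<q | _        = inj₂ (inj₁ (≮⇒≥ i≮p , i<q))
... | no  _   | no  i≮q | yes i<q' = inj₂ (inj₂ (inj₁ (≮⇒≥ i≮q , i<q')))
... | no  _   | no  _   | no  i≮q' = inj₂ (inj₂ (inj₂ (≮⇒≥ i≮q')))

[a+e<ᵇn]≡not[i<ᵇa+[1+i+e]∸n] : ∀ a e i n → (a + e <ᵇ n) ≡ not (i <ᵇ a + (suc i + e) ∸ n)
[a+e<ᵇn]≡not[i<ᵇa+[1+i+e]∸n] a e i n
  rewrite sym (+-assoc a (suc i) e) | +-comm a (suc i) | +-assoc (suc i) a e with a + e <? n
... | yes a+e<n rewrite <⇒<ᵇ≡true a+e<n =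
  sym (cong not (≥⇒<ᵇ≡false (m≤n+o⇒m∸n≤o _ n i+1+a+e≤n+i)))
  where
  i+1+a+e≤n+i : suc i + (a + e) ≤ n + i
  i+1+a+e≤n+i = subst (_≤ n + i) (cong suc (+-comm (a + e) i)) (+-monoˡ-≤ i a+e<n)
... | no  a+e≮n rewrite ≥⇒<ᵇ≡false (≮⇒≥ a+e≮n) | +-∸-assoc (suc i) (≮⇒≥ a+e≮n)
                      | <⇒<ᵇ≡true {i} {suc i + (a + e ∸ n)} (s≤s (m≤m+n i _)) = refl

-- The invariant of the algorithm

module Canonical (r : ℕ) (lam : Vec ℕ r) (lamP : IsPartition lam) where

  cut : ℕ → ℕ → ℕ
  cut J i = part lam i ⊓ J

  record Invariant (J : ℕ) (M : Mat) : Set where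
    field
      len           : ℕ → ℕ
      leftJustified : ∀ i c → c < J → M i c ≡ (c <ᵇ len i)
      len-beyond    : ∀ i → r ≤ i → len i ≡ 0
      len-step      : ∀ i → len (suc i) ≤ len i
      len≤          : ∀ i → len i ≤ J
      len-total     : Σ< r len ≡ Σ< r (cut J)
      len-dominated : ∀ t → Σ< t len ≤ Σ< t (cut J)

  module Conjugate (j₀ : ℕ) (J≤λ₁ : suc j₀ ≤ part lam 0) where

    J n : ℕ
    J = suc j₀
    n = conj r lam J

    reachesJ : ℕ → Bool
    reachesJ k = j₀ <ᵇ part lam k

    n≡count : n ≡ count r reachesJ
    n≡count = Σ<-cong r (λ i _ → if-then-1-else-0 (reachesJ i))

    reachesJ-downClosed : DownClosed r reachesJ
    reachesJ-downClosed k _ e = <⇒<ᵇ≡true (<-≤-trans (<ᵇ≡true⇒< e) (lamP k))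

    <n⇒J≤λ : ∀ {k} → k < n → J ≤ part lam k
    <n⇒J≤λ k<n = <ᵇ≡true⇒< (<count⇒holds reachesJ-downClosed (subst (_ <_) n≡count k<n))

    n≤⇒λ≤j₀ : ∀ {k} → n ≤ k → part lam k ≤ j₀
    n≤⇒λ≤j₀ {k} n≤k with k <? r
    ... | no  k≮r rewrite part-beyond lam k (≮⇒≥ k≮r) = z≤n
    ... | yes k<r with reachesJ k in e
    ...   | false = m<1+n⇒m≤n (<ᵇ≡false⇒≥ e)
    ...   | true  =
      ⊥-elim (<⇒≱ (subst (k <_) (sym n≡count) (holds⇒<count reachesJ-downClosed k<r e)) n≤k)

    0<r : 0 < r
    0<r with 0 <? r
    ... | yes 0<r = 0<r
    ... | no  0≮r = ⊥-elim (<⇒≱ (subst (_ <_) (part-beyond lam 0 (≮⇒≥ 0≮r)) J≤λ₁) z≤n)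

    0<n : 0 < n
    0<n = subst (0 <_) (sym n≡count) (holds⇒<count reachesJ-downClosed 0<r (<⇒<ᵇ≡true J≤λ₁))

    n≤r : n ≤ r
    n≤r = subst (_≤ r) (sym n≡count) (count≤ r reachesJ)

    cut-<n : ∀ {k} → k < n → cut J k ≡ J
    cut-<n k<n = m≥n⇒m⊓n≡n (<n⇒J≤λ k<n)

    cut-≥n : ∀ {k} → n ≤ k → cut J k ≤ j₀
    cut-≥n n≤k = ≤-trans (m⊓n≤m _ J) (n≤⇒λ≤j₀ n≤k)

    cut-suc : ∀ k → cut J k ≡ cut j₀ k + b2n (k <ᵇ n)
    cut-suc k with k <? n
    ... | yes k<n rewrite <⇒<ᵇ≡true k<n | cut-<n k<n
                        | m≥n⇒m⊓n≡n (≤-trans (n≤1+n j₀) (<n⇒J≤λ k<n)) = +-comm 1 j₀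
    ... | no  k≮n rewrite ≥⇒<ᵇ≡false (≮⇒≥ k≮n) | m≤n⇒m⊓n≡m (n≤⇒λ≤j₀ (≮⇒≥ k≮n))
                        | m≤n⇒m⊓n≡m (m≤n⇒m≤1+n (n≤⇒λ≤j₀ (≮⇒≥ k≮n))) =
      sym (+-identityʳ _)

    cut-antitone : ∀ {i k} → i ≤ k → cut J k ≤ cut J i
    cut-antitone i≤k = ⊓-monoˡ-≤ J (antitone (part lam) lamP i≤k)

    Σ<cut-≤n : ∀ t → t ≤ n → Σ< t (cut J) ≡ t * J
    Σ<cut-≤n t t≤n = trans (Σ<-cong t (λ k k<t → cut-<n (<-≤-trans k<t t≤n))) (Σ<-const t J)

  module Selection (j₀ : ℕ) (J≤λ₁ : suc j₀ ≤ part lam 0) (M : Mat) (I : Invariant (suc j₀) M) where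
    open Conjugate j₀ J≤λ₁ public
    open Invariant I public

    len-antitone : ∀ {i k} → i ≤ k → len k ≤ len i
    len-antitone = antitone len len-step

    longer notShorter : ℕ → ℕ
    longer     x = count r (λ k → x <ᵇ len k)
    notShorter x = count r (λ k → x <ᵇ suc (len k))

    longer-downClosed : ∀ x → DownClosed r (λ k → x <ᵇ len k)
    longer-downClosed x k _ e = <⇒<ᵇ≡true {x} (<-≤-trans (<ᵇ≡true⇒< e) (len-step k))

    notShorter-downClosed : ∀ x → DownClosed r (λ k → x <ᵇ suc (len k))
    notShorter-downClosed x k _ e = <⇒<ᵇ≡true {x} (<-≤-trans (<ᵇ≡true⇒< e) (s≤s (len-step k)))

    module _ {x k : ℕ} where

      <longer : k < r → x < len k → k < longer x
      <longer k<r x<len = holds⇒<count (longer-downClosed x) k<r (<⇒<ᵇ≡true x<len)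

      <longer⇒< : k < longer x → x < len k
      <longer⇒< k<l = <ᵇ≡true⇒< (<count⇒holds (longer-downClosed x) k<l)

      longer≤ : len k ≤ x → longer x ≤ k
      longer≤ len≤x = ≮⇒≥ (λ k<l → <⇒≱ (<longer⇒< k<l) len≤x)

      <notShorter : k < r → x ≤ len k → k < notShorter x
      <notShorter k<r x≤len = holds⇒<count (notShorter-downClosed x) k<r (<⇒<ᵇ≡true (s≤s x≤len))

      <notShorter⇒≤ : k < notShorter x → x ≤ len k
      <notShorter⇒≤ k<s = m<1+n⇒m≤n (<ᵇ≡true⇒< (<count⇒holds (notShorter-downClosed x) k<s))

      notShorter≤ : len k < x → notShorter x ≤ k
      notShorter≤ len<x = ≮⇒≥ (λ k<s → <⇒≱ len<x (<notShorter⇒≤ k<s))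

    rowCount≡len : ∀ i → rowCount M i J ≡ len i
    rowCount≡len i = trans (Σ<-cong J (λ c c<J → cong b2n (leftJustified i c c<J)))
                           (count-<ᵇ J (len i) (len≤ i))

    -- The rows beating row i: the longer rows, and the rows of the same length south of i.
    beats-split : ∀ i → i < r → ∀ k → k < r →
      b2n (beats M J k i) ≡ b2n (len i <ᵇ len k) + b2n (not (k <ᵇ suc i) ∧ (k <ᵇ notShorter (len i)))
    beats-split i i<r k k<r rewrite rowCount≡len i | rowCount≡len k with <-cmp (len i) (len k)
    ... | tri< i<k _ _ rewrite <⇒<ᵇ≡true i<k
                             | <⇒<ᵇ≡true (s≤s (<⇒≤ (<-≤-trans (<longer k<r i<k) (longer≤ ≤-refl)))) =
      refl
    ... | tri≈ _ i≡k _ rewrite sym i≡k | ≥⇒<ᵇ≡false (≤-refl {len i}) | ≡ᵇ-refl (len i)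
                             | <⇒<ᵇ≡true (<notShorter k<r (≤-reflexive i≡k)) with i <? k
    ...   | yes i<k rewrite <⇒<ᵇ≡true i<k | ≥⇒<ᵇ≡false i<k = refl
    ...   | no  i≮k rewrite ≥⇒<ᵇ≡false (≮⇒≥ i≮k) | <⇒<ᵇ≡true (s≤s (≮⇒≥ i≮k)) = refl
    beats-split i i<r k k<r | tri> _ _ k<i
      rewrite ≥⇒<ᵇ≡false (<⇒≤ k<i) | ≢⇒≡ᵇ≡false (<⇒≢ k<i) | ≥⇒<ᵇ≡false (notShorter≤ k<i)
            | ∧-zeroʳ (not (k <ᵇ suc i)) = refl

    rank≡ : ∀ i → i < r → rank r M J i ≡ longer (len i) + (notShorter (len i) ∸ suc i)
    rank≡ i i<r = begin
      rank r M J i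
        ≡⟨ Σ<-cong r (beats-split i i<r) ⟩
      Σ< r (λ k → b2n (len i <ᵇ len k) + b2n (not (k <ᵇ suc i) ∧ (k <ᵇ notShorter (len i))))
        ≡⟨ Σ<-distrib-+ r _ _ ⟩
      longer (len i) + count r (λ k → not (k <ᵇ suc i) ∧ (k <ᵇ notShorter (len i)))
        ≡⟨ cong (longer (len i) +_) (count-interval r (suc i) (notShorter (len i))
                  (<notShorter i<r ≤-refl) (count≤ r _)) ⟩
      longer (len i) + (notShorter (len i) ∸ suc i) ∎
      where open ≡-Reasoning

    n' : ℕ
    n' = n ∸ 1

    1+n'≡n : suc n' ≡ n
    1+n'≡n = m+[n∸m]≡n 0<n

    n'<r : n' < r
    n'<r = subst (_≤ r) (sym 1+n'≡n) n≤r

    -- T is the length of the n-th longest row; rows 0, …, a - 1 are longer than T and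
    -- rows a, …, b - 1 have length T, of which the southmost n - a (from q on) are chosen.
    T a b q : ℕ
    T = len n'
    a = longer T
    b = notShorter T
    q = a + b ∸ n

    a<n : a < n
    a<n = subst (a <_) 1+n'≡n (s≤s (longer≤ ≤-refl))

    n≤b : n ≤ b
    n≤b = subst (_≤ b) 1+n'≡n (<notShorter n'<r ≤-refl)

    b≤r : b ≤ r
    b≤r = count≤ r _

    q≡ : q ≡ a + (b ∸ n)
    q≡ = +-∸-assoc a n≤b

    a≤q : a ≤ q
    a≤q = subst (a ≤_) (sym q≡) (m≤m+n a _)

    q<b : q < b
    q<b = subst (_< b) (sym q≡) (begin-strict
      a + (b ∸ n) <⟨ +-monoˡ-< (b ∸ n) a<n ⟩
      n + (b ∸ n) ≡⟨ m+[n∸m]≡n n≤b ⟩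
      b           ∎)
      where open ≤-Reasoning

    a≤b : a ≤ b
    a≤b = ≤-trans a≤q (<⇒≤ q<b)

    len-<a : ∀ {i} → i < a → T < len i
    len-<a = <longer⇒<

    len[a]≤T : len a ≤ T
    len[a]≤T = ≮⇒≥ (λ T<len → <-irrefl refl (<longer (<-≤-trans a<n n≤r) T<len))

    len≡T : ∀ {i} → a ≤ i → i < b → len i ≡ T
    len≡T a≤i i<b = ≤-antisym (≮⇒≥ (λ T<len → <⇒≱ (<longer (<-≤-trans i<b b≤r) T<len) a≤i))
                                  (<notShorter⇒≤ i<b)

    b≤longer : ∀ {i} → len i < T → b ≤ longer (len i)
    b≤longer len<T = ≮⇒≥ (λ l<b → <-irrefl refl
      (<longer (<-≤-trans l<b b≤r) (<-≤-trans len<T (<notShorter⇒≤ l<b))))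

    selected : ℕ → Bool
    selected = twoRuns a q b

    chosen≡selected : ∀ i → chosen r n M J i ≡ selected i
    chosen≡selected i with i <? r
    ... | no  i≮r rewrite ≥⇒<ᵇ≡false (≮⇒≥ i≮r) =
      sym (twoRuns-beyond a q b a≤b (≤-trans b≤r (≮⇒≥ i≮r)))
    ... | yes i<r rewrite <⇒<ᵇ≡true i<r | rank≡ i i<r with <-cmp T (len i)
    ...   | tri< T<len _ _ rewrite twoRuns-first a q b (<longer i<r T<len) =
      <⇒<ᵇ≡true (<-trans rank<a a<n)
      where
      i<a = <longer i<r T<len
      rank<a : longer (len i) + (notShorter (len i) ∸ suc i) < a
      rank<a = begin-strict
        longer (len i) + (notShorter (len i) ∸ suc i)
          ≤⟨ +-mono-≤ (longer≤ ≤-refl)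
                      (∸-monoˡ-≤ (suc i) (notShorter≤ (≤-<-trans len[a]≤T T<len))) ⟩
        i + (a ∸ suc i)  <⟨ ≤-refl ⟩
        suc i + (a ∸ suc i) ≡⟨ m+[n∸m]≡n i<a ⟩
        a                ∎
        where open ≤-Reasoning
    ...   | tri≈ _ T≡len _ -- rank a + (b - 1 - i) < n iff i ≥ q
      rewrite ≥⇒<ᵇ≡false {i} {a} (longer≤ (≤-reflexive (sym T≡len)))
            | <⇒<ᵇ≡true (<notShorter {T} i<r (≤-reflexive T≡len))
            | ∧-identityʳ (not (i <ᵇ q)) | sym T≡len =
      trans ([a+e<ᵇn]≡not[i<ᵇa+[1+i+e]∸n] a (b ∸ suc i) i n)
            (cong (λ x → not (i <ᵇ a + x ∸ n))
                  (m+[n∸m]≡n (<notShorter {T} i<r (≤-reflexive T≡len))))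
    ...   | tri> _ _ len<T rewrite twoRuns-beyond a q b a≤b (notShorter≤ len<T) =
      ≥⇒<ᵇ≡false (≤-trans n≤b (≤-trans (b≤longer len<T) (m≤m+n _ _)))

    len-vanishes-after : ∀ {k} → len k ≡ 0 → ∀ i → k ≤ i → len i ≡ 0
    len-vanishes-after len≡0 i k≤i = n≤0⇒n≡0 (subst (len i ≤_) len≡0 (len-antitone k≤i))

    -- If T = 0, all of len lies in rows 0, …, n - 2, where it is bounded by cut J; but row
    -- n - 1 of cut J is nonempty, contradicting equality of the totals.
    1≤T : 1 ≤ T
    1≤T with T in T≡
    ... | suc _ = s≤s z≤n
    ... | zero  = ⊥-elim (<-irrefl refl (begin-strict
      Σ< r len                ≡⟨ Σ<-vanishing-tail n' r len (<⇒≤ n'<r) (len-vanishes-after T≡) ⟩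
      Σ< n' len               ≤⟨ len-dominated n' ⟩
      Σ< n' (cut J)           <⟨ m<m+n _ (subst (0 <_) (sym (cut-<n (subst (n' <_) 1+n'≡n ≤-refl))) z<s) ⟩
      Σ< n' (cut J) + cut J n' ≡⟨ cong (λ t → Σ< t (cut J)) 1+n'≡n ⟩
      Σ< n (cut J)            ≤⟨ Σ<-mono-length n r (cut J) n≤r ⟩
      Σ< r (cut J)            ≡⟨ sym len-total ⟩
      Σ< r len                ∎))
      where open ≤-Reasoning

    -- a < q means n < b; if moreover T = J then rows 0, …, n all have length J, exceeding
    -- the n·J + j₀ cells in the first n + 1 rows of cut J.
    T<J : a < q → T < J
    T<J a<q with m≤n⇒m<n∨m≡n (len≤ n')
    ... | inj₁ T<J = T<J
    ... | inj₂ T≡J = ⊥-elim (1+n≰n (+-cancelˡ-≤ (n * J) J j₀ (begin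
      n * J + J               ≡⟨ +-comm (n * J) J ⟩
      suc n * J               ≡⟨ sym (Σ<-const (suc n) J) ⟩
      Σ< (suc n) (λ _ → J)    ≡⟨ sym (Σ<-cong (suc n) len≡J) ⟩
      Σ< (suc n) len          ≤⟨ len-dominated (suc n) ⟩
      Σ< n (cut J) + cut J n  ≤⟨ +-mono-≤ (≤-reflexive (Σ<cut-≤n n ≤-refl)) (cut-≥n ≤-refl) ⟩
      n * J + j₀              ∎)))
      where
      open ≤-Reasoning
      n<b : n < b
      n<b = ≮⇒≥ (λ b≤n → <-irrefl refl (subst (a <_)
              (trans q≡ (trans (cong (a +_) (m≤n⇒m∸n≡0 b≤n)) (+-identityʳ a))) a<q))
      len≡J : ∀ k → k < suc n → len k ≡ J
      len≡J k k<1+n =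
        ≤-antisym (len≤ k) (subst (_≤ len k) T≡J (<notShorter⇒≤ (<-≤-trans k<1+n n<b)))

    b≤⇒len<T : ∀ {i} → b ≤ i → len i < T
    b≤⇒len<T {i} b≤i with i <? r
    ... | yes i<r = ≰⇒> (λ T≤len → <⇒≱ (<notShorter i<r T≤len) b≤i)
    ... | no  i≮r rewrite len-beyond i (≮⇒≥ i≮r) = 1≤T

    1≤len⇒<r : ∀ {k} → 1 ≤ len k → k < r
    1≤len⇒<r {k} 1≤len with k <? r
    ... | yes k<r = k<r
    ... | no  k≮r = ⊥-elim (<⇒≱ 1≤len (≤-reflexive (len-beyond k (≮⇒≥ k≮r))))

    unselected⇒len<J : ∀ {i} → selected i ≡ false → len i < J
    unselected⇒len<J {i} sel with locate a q b i
    ... | inj₁ i<a = ⊥-elim (true≢false (trans (sym (twoRuns-first a q b i<a)) sel))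
    ... | inj₂ (inj₁ (a≤i , i<q)) =
      subst (_< J) (sym (len≡T a≤i (<-trans i<q q<b))) (T<J (≤-<-trans a≤i i<q))
    ... | inj₂ (inj₂ (inj₁ (q≤i , i<b))) =
      ⊥-elim (true≢false (trans (sym (twoRuns-second a q b q≤i i<b)) sel))
    ... | inj₂ (inj₂ (inj₂ b≤i)) = <-≤-trans (b≤⇒len<T b≤i) (len≤ n')

    selected⇒1≤len : ∀ {i} → selected i ≡ true → 1 ≤ len i
    selected⇒1≤len {i} sel with locate a q b i
    ... | inj₁ i<a = ≤-trans 1≤T (<⇒≤ (len-<a i<a))
    ... | inj₂ (inj₁ (a≤i , i<q)) =
      ⊥-elim (true≢false (trans (sym sel) (twoRuns-gap a q b a≤i i<q)))
    ... | inj₂ (inj₂ (inj₁ (q≤i , i<b))) = subst (1 ≤_) (sym (len≡T (≤-trans a≤q q≤i) i<b)) 1≤T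
    ... | inj₂ (inj₂ (inj₂ b≤i)) =
      ⊥-elim (true≢false (trans (sym sel) (twoRuns-beyond a q b a≤b b≤i)))

    selected-suc : ∀ {i} → len (suc i) ≡ len i → selected i ≡ true → selected (suc i) ≡ true
    selected-suc {i} len≡ sel with locate a q b i
    ... | inj₁ i<a = twoRuns-first a q b (<longer (1≤len⇒<r 1≤len) T<len)
      where
      T<len = subst (T <_) (sym len≡) (len-<a i<a)
      1≤len = ≤-trans 1≤T (<⇒≤ T<len)
    ... | inj₂ (inj₁ (a≤i , i<q)) =
      ⊥-elim (true≢false (trans (sym sel) (twoRuns-gap a q b a≤i i<q)))
    ... | inj₂ (inj₂ (inj₁ (q≤i , i<b))) =
      twoRuns-second a q b (m≤n⇒m≤1+n q≤i)
        (<notShorter (1≤len⇒<r 1≤len) (≤-reflexive (sym len[1+i]≡T)))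
      where
      len[1+i]≡T = trans len≡ (len≡T (≤-trans a≤q q≤i) i<b)
      1≤len = subst (1 ≤_) (sym len[1+i]≡T) 1≤T
    ... | inj₂ (inj₂ (inj₂ b≤i)) =
      ⊥-elim (true≢false (trans (sym sel) (twoRuns-beyond a q b a≤b b≤i)))

  module Update (j₀ : ℕ) (J≤λ₁ : suc j₀ ≤ part lam 0) (M : Mat) (I : Invariant (suc j₀) M) where
    open Selection j₀ J≤λ₁ M I public

    M' : Mat
    M' = step r lam J M

    M'-unselected : ∀ {i} c → selected i ≡ false → M' i c ≡ M i c
    M'-unselected {i} c sel =
      cong (λ x → if x then moveRow M J i c else M i c) (trans (chosen≡selected i) sel)

    M'-selected : ∀ {i y} c → len i ≡ suc y → selected i ≡ true →
      M' i c ≡ (if c ≡ᵇ j₀ then true else (if c ≡ᵇ y then false else M i c))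
    M'-selected {i} {y} c len≡ sel =
      trans (cong (λ x → if x then moveRow M J i c else M i c) (trans (chosen≡selected i) sel))
            (moveRow-just M J i c (rightmost-leftJustified (M i) J y y<J leftJustified-y))
      where
      y<J = subst (_≤ J) len≡ (len≤ i)
      leftJustified-y : ∀ c → c < J → M i c ≡ (c <ᵇ suc y)
      leftJustified-y c c<J = trans (leftJustified i c c<J) (cong (c <ᵇ_) len≡)

    len≡1+pred : ∀ {i} → selected i ≡ true → len i ≡ suc (len i ∸ 1)
    len≡1+pred sel = sym (m+[n∸m]≡n (selected⇒1≤len sel))

    newColumn : ∀ i → M' i j₀ ≡ selected i
    newColumn i with selected i in sel
    ... | false = trans (M'-unselected j₀ sel) (trans (leftJustified i j₀ ≤-refl)
                    (≥⇒<ᵇ≡false (m<1+n⇒m≤n (unselected⇒len<J sel))))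
    ... | true  = trans (M'-selected j₀ (len≡1+pred sel) sel)
                    (cong (λ x → if x then true else (if j₀ ≡ᵇ len i ∸ 1 then false else M i j₀))
                          (≡ᵇ-refl j₀))

    len' : ℕ → ℕ
    len' i = len i ∸ b2n (selected i)

    leftJustified' : ∀ i c → c < j₀ → M' i c ≡ (c <ᵇ len' i)
    leftJustified' i c c<j₀ with selected i in sel
    ... | false = trans (M'-unselected c sel) (leftJustified i c (m<n⇒m<1+n c<j₀))
    ... | true  = begin
      M' i c                                                       ≡⟨ M'-selected c len≡ sel ⟩
      (if c ≡ᵇ j₀ then true else (if c ≡ᵇ y then false else M i c))
        ≡⟨ cong (λ x → if x then true else (if c ≡ᵇ y then false else M i c))
                (≢⇒≡ᵇ≡false (<⇒≢ c<j₀)) ⟩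
      (if c ≡ᵇ y then false else M i c)
        ≡⟨ cong (if c ≡ᵇ y then false else_)
                (trans (leftJustified i c (m<n⇒m<1+n c<j₀)) (cong (c <ᵇ_) len≡)) ⟩
      (if c ≡ᵇ y then false else (c <ᵇ suc y))                     ≡⟨ <ᵇ-suc-minus-last c y ⟩
      c <ᵇ y                                                       ∎
      where
      open ≡-Reasoning
      y = len i ∸ 1
      len≡ = len≡1+pred sel

    len'-beyond : ∀ i → r ≤ i → len' i ≡ 0
    len'-beyond i r≤i rewrite len-beyond i r≤i = 0∸n≡0 (b2n (selected i))

    len'≤ : ∀ i → len' i ≤ j₀
    len'≤ i with selected i in sel
    ... | true  = ∸-monoˡ-≤ 1 (len≤ i)
    ... | false = m<1+n⇒m≤n (unselected⇒len<J sel)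

    len'-step : ∀ i → len' (suc i) ≤ len' i
    len'-step i with m≤n⇒m<n∨m≡n (len-step i)
    ... | inj₁ len<len = begin
      len' (suc i)   ≤⟨ m∸n≤m (len (suc i)) (b2n (selected (suc i))) ⟩
      len (suc i)    ≤⟨ <⇒≤pred len<len ⟩
      pred (len i)   ≡⟨ pred[m∸n]≡m∸[1+n] (len i) 0 ⟩
      len i ∸ 1      ≤⟨ ∸-monoʳ-≤ (len i) (b2n≤1 (selected i)) ⟩
      len' i         ∎
      where open ≤-Reasoning
    ... | inj₂ len≡len rewrite len≡len =
      ∸-monoʳ-≤ (len i) (b2n-mono (selected i) (selected (suc i)) (selected-suc len≡len))

    len≡len'+selected : ∀ k → len k ≡ len' k + b2n (selected k)
    len≡len'+selected k with selected k in sel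
    ... | true  = sym (m∸n+n≡m (selected⇒1≤len sel))
    ... | false = sym (+-identityʳ (len k))

    Σ<len-split : ∀ t → Σ< t len ≡ Σ< t len' + count t selected
    Σ<len-split t = trans (Σ<-cong t (λ k _ → len≡len'+selected k)) (Σ<-distrib-+ t len' _)

    Σ<cut-split : ∀ t → Σ< t (cut J) ≡ Σ< t (cut j₀) + count t (_<ᵇ n)
    Σ<cut-split t = trans (Σ<-cong t (λ k _ → cut-suc k)) (Σ<-distrib-+ t (cut j₀) _)

    count-selected : ∀ t → b ≤ t → count t selected ≡ n
    count-selected t b≤t = begin
      count t selected  ≡⟨ count-twoRuns t a≤q (<⇒≤ q<b) b≤t ⟩
      a + (b ∸ q)       ≡⟨ cong (λ x → a + (b ∸ x)) (trans q≡ (+-comm a (b ∸ n))) ⟩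
      a + (b ∸ (b ∸ n + a)) ≡⟨ cong (a +_) (sym (∸-+-assoc b (b ∸ n) a)) ⟩
      a + (b ∸ (b ∸ n) ∸ a) ≡⟨ cong (λ x → a + (x ∸ a)) (m∸[m∸n]≡n n≤b) ⟩
      a + (n ∸ a)       ≡⟨ m+[n∸m]≡n (<⇒≤ a<n) ⟩
      n                 ∎
      where open ≡-Reasoning

    count-selected-≤a : ∀ t → t ≤ a → count t selected ≡ t
    count-selected-≤a t t≤a = count-all t selected (λ k k<t → twoRuns-first a q b (<-≤-trans k<t t≤a))

    count-selected-≥a : ∀ t → a ≤ t → a ≤ count t selected
    count-selected-≥a t a≤t = subst (_≤ count t selected) (count-selected-≤a a ≤-refl)
                                    (Σ<-mono-length a t _ a≤t)

    count-selected-a≡q : a ≡ q → ∀ t → t ≤ b → count t selected ≡ t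
    count-selected-a≡q a≡q t t≤b = count-all t selected all
      where
      all : ∀ k → k < t → selected k ≡ true
      all k k<t with k <? a
      ... | yes k<a = twoRuns-first a q b k<a
      ... | no  k≮a = twoRuns-second a q b (subst (_≤ k) a≡q (≮⇒≥ k≮a)) (<-≤-trans k<t t≤b)

    n≤count-selected+rest : ∀ t → t ≤ b → n ≤ count t selected + (b ∸ t)
    n≤count-selected+rest t t≤b with m≤n⇒∃[o]m+o≡n t≤b
    ... | d , t+d≡b = begin
      n                        ≡⟨ sym (count-selected b ≤-refl) ⟩
      count b selected         ≡⟨ cong (λ x → count x selected) (sym t+d≡b) ⟩
      count (t + d) selected   ≤⟨ Σ<-extend-≤ t d _ 1 (λ k _ _ → b2n≤1 (selected k)) ⟩
      count t selected + d * 1 ≡⟨ cong (count t selected +_) (trans (*-identityʳ d) d≡) ⟩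
      count t selected + (b ∸ t) ∎
      where
      open ≤-Reasoning
      d≡ : d ≡ b ∸ t
      d≡ = sym (trans (cong (_∸ t) (sym t+d≡b)) (m+n∸m≡n t d))

    -- Dominance of len' by cut j₀ at t, with both sides enlarged by the cells of column J.
    ShiftedDominance : ℕ → Set
    ShiftedDominance t = Σ< t len + count t (_<ᵇ n) ≤ Σ< t (cut J) + count t selected

    shiftedDominance-≤n : ∀ t → t ≤ n → Σ< t len + t ≤ Σ< t (cut J) + count t selected
    shiftedDominance-≤n t t≤n with t ≤? a | a ≟ q
    ... | yes t≤a | _ rewrite count-selected-≤a t t≤a = +-monoˡ-≤ t (len-dominated t)
    ... | no  _ | yes a≡q rewrite count-selected-a≡q a≡q t (≤-trans t≤n n≤b) =
      +-monoˡ-≤ t (len-dominated t)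
    ... | no  t≰a | no a≢q with m≤n⇒∃[o]m+o≡n (<⇒≤ (≰⇒> t≰a))
    ...   | d , refl = begin
      Σ< (a + d) len + (a + d)        ≡⟨ cong (_+ (a + d)) Σ<len ⟩
      Σ< a len + d * T + (a + d)      ≡⟨ rearrange (Σ< a len) (d * T) a d ⟩
      Σ< a len + (d * T + d) + a      ≤⟨ +-monoˡ-≤ a (+-mono-≤ (len-dominated a) dT+d≤dJ) ⟩
      Σ< a (cut J) + d * J + a        ≡⟨ cong (_+ a) (sym Σ<cut) ⟩
      Σ< (a + d) (cut J) + a          ≤⟨ +-monoʳ-≤ _ (count-selected-≥a (a + d) (m≤m+n a d)) ⟩
      Σ< (a + d) (cut J) + count (a + d) selected ∎
      where
      open ≤-Reasoning
      Σ<len : Σ< (a + d) len ≡ Σ< a len + d * T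
      Σ<len = Σ<-extend-≡ a d len T (λ k a≤k k<t → len≡T a≤k (<-≤-trans k<t (≤-trans t≤n n≤b)))
      Σ<cut : Σ< (a + d) (cut J) ≡ Σ< a (cut J) + d * J
      Σ<cut = Σ<-extend-≡ a d (cut J) J (λ k _ k<t → cut-<n (<-≤-trans k<t t≤n))
      dT+d≤dJ : d * T + d ≤ d * J
      dT+d≤dJ = subst (_≤ d * J) (trans (*-suc d T) (+-comm d (d * T)))
                      (*-monoʳ-≤ d (T<J (≤∧≢⇒< a≤q a≢q)))
      rearrange : ∀ x y z w → x + y + (z + w) ≡ x + (y + w) + z
      rearrange x y z w = begin-equality
        x + y + (z + w)  ≡⟨ cong (x + y +_) (+-comm z w) ⟩
        x + y + (w + z)  ≡⟨ sym (+-assoc (x + y) w z) ⟩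
        x + y + w + z    ≡⟨ cong (_+ z) (+-assoc x y w) ⟩
        x + (y + w) + z  ∎

    -- If row t - 1 of cut J is shorter than T, then on rows t, …, b - 1 len exceeds cut J by
    -- at least one cell per row, so dominance at b leaves a surplus of b - t cells before t.
    shiftedDominance-shortCut : ∀ t' → n < suc t' → suc t' ≤ b → cut J t' < T →
      Σ< (suc t') len + n ≤ Σ< (suc t') (cut J) + count (suc t') selected
    shiftedDominance-shortCut t' n<t t≤b cut<T with m≤n⇒∃[o]m+o≡n t≤b
    ... | d , t+d≡b = begin
      Σ< t len + n                          ≤⟨ +-monoʳ-≤ (Σ< t len) (n≤count-selected+rest t t≤b) ⟩
      Σ< t len + (count t selected + (b ∸ t))
        ≡⟨ cong (λ x → Σ< t len + (count t selected + x)) b∸t≡d ⟩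
      Σ< t len + (count t selected + d)     ≡⟨ rearrange (Σ< t len) (count t selected) d ⟩
      Σ< t len + d + count t selected       ≤⟨ +-monoˡ-≤ (count t selected) surplus ⟩
      Σ< t (cut J) + count t selected       ∎
      where
      open ≤-Reasoning
      t = suc t'
      b∸t≡d : b ∸ t ≡ d
      b∸t≡d = trans (cong (_∸ t) (sym t+d≡b)) (m+n∸m≡n t d)
      rearrange : ∀ x y z → x + (y + z) ≡ x + z + y
      rearrange x y z = trans (cong (x +_) (+-comm y z)) (sym (+-assoc x z y))
      T≡ : T ≡ suc (pred T)
      T≡ = sym (suc-pred T {{>-nonZero 1≤T}})
      Σ<len : Σ< (t + d) len ≡ Σ< t len + d * T
      Σ<len = Σ<-extend-≡ t d len T (λ k t≤k k<t+d →
                len≡T (≤-trans (<⇒≤ a<n) (≤-trans (<⇒≤ n<t) t≤k)) (subst (k <_) t+d≡b k<t+d))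
      surplus : Σ< t len + d ≤ Σ< t (cut J)
      surplus = +-cancelʳ-≤ (d * pred T) _ _ (begin
        Σ< t len + d + d * pred T   ≡⟨ +-assoc (Σ< t len) d _ ⟩
        Σ< t len + (d + d * pred T) ≡⟨ cong (Σ< t len +_) (sym (trans (cong (d *_) T≡)
                                                                         (*-suc d (pred T)))) ⟩
        Σ< t len + d * T            ≡⟨ sym Σ<len ⟩
        Σ< (t + d) len              ≤⟨ len-dominated (t + d) ⟩
        Σ< (t + d) (cut J)          ≤⟨ Σ<-extend-≤ t d (cut J) (pred T) (λ k t≤k _ →
                                         ≤-trans (cut-antitone (<⇒≤ t≤k)) (<⇒≤pred cut<T)) ⟩
        Σ< t (cut J) + d * pred T   ∎)

    -- Otherwise rows n, …, t - 1 have length T in len and at least T in cut J.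
    shiftedDominance-longCut : ∀ t' → n < suc t' → suc t' ≤ b → T ≤ cut J t' →
      Σ< (suc t') len + n ≤ Σ< (suc t') (cut J) + count (suc t') selected
    shiftedDominance-longCut t' n<t t≤b T≤cut with m≤n⇒∃[o]m+o≡n (<⇒≤ n<t)
    ... | d , n+d≡t = subst (λ t → Σ< t len + n ≤ Σ< t (cut J) + count t selected) n+d≡t (begin
      Σ< (n + d) len + n                        ≡⟨ cong (_+ n) Σ<len ⟩
      Σ< n len + d * T + n                      ≡⟨ swap (Σ< n len) (d * T) n ⟩
      Σ< n len + n + d * T                      ≤⟨ +-monoˡ-≤ (d * T) (shiftedDominance-≤n n ≤-refl) ⟩
      Σ< n (cut J) + count n selected + d * T   ≡⟨ swap (Σ< n (cut J)) (count n selected) (d * T) ⟩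
      Σ< n (cut J) + d * T + count n selected
        ≤⟨ +-mono-≤ Σ<cut (Σ<-mono-length n (n + d) _ (m≤m+n n d)) ⟩
      Σ< (n + d) (cut J) + count (n + d) selected ∎)
      where
      open ≤-Reasoning
      k<t : ∀ {k} → k < n + d → k < suc t'
      k<t {k} = subst (k <_) n+d≡t
      Σ<len : Σ< (n + d) len ≡ Σ< n len + d * T
      Σ<len = Σ<-extend-≡ n d len T (λ k n≤k k<n+d →
                len≡T (≤-trans (<⇒≤ a<n) n≤k) (<-≤-trans (k<t k<n+d) t≤b))
      Σ<cut : Σ< n (cut J) + d * T ≤ Σ< (n + d) (cut J)
      Σ<cut = Σ<-extend-≥ n d (cut J) T (λ k _ k<n+d →
                ≤-trans T≤cut (cut-antitone (m<1+n⇒m≤n (k<t k<n+d))))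
      swap : ∀ x y z → x + y + z ≡ x + z + y
      swap x y z = trans (+-assoc x y z) (trans (cong (x +_) (+-comm y z)) (sym (+-assoc x z y)))

    shiftedDominance : ∀ t → ShiftedDominance t
    shiftedDominance zero     = z≤n
    shiftedDominance (suc t') with suc t' ≤? n
    ... | yes t≤n rewrite count-all (suc t') (_<ᵇ n) (λ k k<t → <⇒<ᵇ≡true (<-≤-trans k<t t≤n)) =
      shiftedDominance-≤n (suc t') t≤n
    ... | no  t≰n rewrite count-<ᵇ (suc t') n (<⇒≤ (≰⇒> t≰n)) with b ≤? suc t' | cut J t' <? T
    ...   | yes b≤t | _ rewrite count-selected (suc t') b≤t = +-monoˡ-≤ n (len-dominated (suc t'))
    ...   | no  b≰t | yes cut<T =
      shiftedDominance-shortCut t' (≰⇒> t≰n) (<⇒≤ (≰⇒> b≰t)) cut<T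
    ...   | no  b≰t | no  cut≮T =
      shiftedDominance-longCut t' (≰⇒> t≰n) (<⇒≤ (≰⇒> b≰t)) (≮⇒≥ cut≮T)

    len'-dominated : ∀ t → Σ< t len' ≤ Σ< t (cut j₀)
    len'-dominated t = +-cancelʳ-≤ (σ + ε) _ _ (begin
      Σ< t len' + (σ + ε)      ≡⟨ sym (+-assoc (Σ< t len') σ ε) ⟩
      Σ< t len' + σ + ε        ≡⟨ cong (_+ ε) (sym (Σ<len-split t)) ⟩
      Σ< t len + ε             ≤⟨ shiftedDominance t ⟩
      Σ< t (cut J) + σ         ≡⟨ cong (_+ σ) (Σ<cut-split t) ⟩
      Σ< t (cut j₀) + ε + σ    ≡⟨ +-assoc (Σ< t (cut j₀)) ε σ ⟩
      Σ< t (cut j₀) + (ε + σ)  ≡⟨ cong (Σ< t (cut j₀) +_) (+-comm ε σ) ⟩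
      Σ< t (cut j₀) + (σ + ε)  ∎)
      where
      open ≤-Reasoning
      σ = count t selected
      ε = count t (_<ᵇ n)

    len'-total : Σ< r len' ≡ Σ< r (cut j₀)
    len'-total = +-cancelʳ-≡ n _ _ (begin
      Σ< r len' + n                  ≡⟨ cong (Σ< r len' +_) (sym (count-selected r b≤r)) ⟩
      Σ< r len' + count r selected   ≡⟨ sym (Σ<len-split r) ⟩
      Σ< r len                       ≡⟨ len-total ⟩
      Σ< r (cut J)                   ≡⟨ Σ<cut-split r ⟩
      Σ< r (cut j₀) + count r (_<ᵇ n) ≡⟨ cong (Σ< r (cut j₀) +_) (count-<ᵇ r n n≤r) ⟩
      Σ< r (cut j₀) + n              ∎)
      where open ≡-Reasoning

    invariant' : Invariant j₀ M'
    invariant' = record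
      { len = len' ; leftJustified = leftJustified' ; len-beyond = len'-beyond ; len-step = len'-step
      ; len≤ = len'≤ ; len-total = len'-total ; len-dominated = len'-dominated }

    newColumn-type : ColumnType (column r M' j₀)
    newColumn-type = column-twoRuns r (λ i → M' i j₀) a≤q q<b b≤r (λ i _ → newColumn i)

    firstColumn-type1 : j₀ ≡ 0 → Type1 (column r M' j₀)
    firstColumn-type1 refl = column-initialRun r (λ i → M' i 0) (<-≤-trans 0<n n≤b) b≤r
                               (λ i _ → trans (newColumn i) (cong₂ (λ x y → twoRuns x y b i) a≡0 q≡0))
      where
      open ≤-Reasoning
      a≡0 : a ≡ 0
      a≡0 = n≤0⇒n≡0 (longer≤ (≤-trans (len≤ 0) 1≤T))
      b≤n : b ≤ n
      b≤n = begin
        b                            ≤⟨ m≤m*n b T {{>-nonZero 1≤T}} ⟩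
        b * T                        ≤⟨ Σ<-extend-≥ 0 b len T (λ k _ k<b → <notShorter⇒≤ k<b) ⟩
        Σ< b len                     ≤⟨ Σ<-mono-length b r len b≤r ⟩
        Σ< r len                     ≡⟨ len-total ⟩
        Σ< r (cut 1)                 ≡⟨ Σ<cut-split r ⟩
        Σ< r (cut 0) + count r (_<ᵇ n)
          ≡⟨ cong₂ _+_ (Σ<-cong r (λ k _ → ⊓-zeroʳ (part lam k))) (count-<ᵇ r n n≤r) ⟩
        Σ< r (λ _ → 0) + n           ≡⟨ cong (_+ n) (trans (Σ<-const r 0) (*-zeroʳ r)) ⟩
        n                            ∎
      q≡0 : q ≡ 0
      q≡0 = trans q≡ (cong₂ _+_ a≡0 (m≤n⇒m∸n≡0 b≤n))

  run-columnTypes : ∀ j M → j ≤ part lam 0 → Invariant j M →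
    (∀ c → c < j → ColumnType (column r (run r lam j M) c)) ×
    (0 < j → Type1 (column r (run r lam j M) 0))
  run-columnTypes zero     M _     _ = (λ _ ()) , (λ ())
  run-columnTypes (suc j₀) M J≤λ₁ I = earlierColumns , firstColumn
    where
    open Update j₀ J≤λ₁ M I using (M'; invariant'; newColumn-type; firstColumn-type1)
    IH = run-columnTypes j₀ M' (<⇒≤ J≤λ₁) invariant'
    fixed : ∀ c → j₀ ≤ c → column r (run r lam j₀ M') c ≡ column r M' c
    fixed c j₀≤c = map-cong (λ i → run-fixes-right r lam j₀ M' i c j₀≤c) (upTo r)
    earlierColumns : ∀ c → c < suc j₀ → ColumnType (column r (run r lam j₀ M') c)
    earlierColumns c c<1+j₀ with m<1+n⇒m<n∨m≡n c<1+j₀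
    ... | inj₁ c<j₀ = proj₁ IH c c<j₀
    ... | inj₂ refl = subst ColumnType (sym (fixed c ≤-refl)) newColumn-type
    firstColumn : 0 < suc j₀ → Type1 (column r (run r lam j₀ M') 0)
    firstColumn _ with j₀ ≟ 0
    ... | no  j₀≢0 = proj₂ IH (n≢0⇒n>0 j₀≢0)
    ... | yes refl = subst Type1 (sym (fixed 0 ≤-refl)) (firstColumn-type1 refl)

  initialInvariant : ∀ mu → Kostka r lam mu → Invariant (part lam 0) (initMat r mu)
  initialInvariant mu (_ , muP , total , dominance) = record
    { len = part mu ; leftJustified = leftJustified ; len-beyond = part-beyond mu ; len-step = muP
    ; len≤ = λ i → ≤-trans (antitone (part mu) muP z≤n) μ₁≤λ₁
    ; len-total = trans (sym total) (Σ<-cong r (λ k _ → sym (cut-λ₁ k))) ; len-dominated = dominated }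
    where
    cut-λ₁ : ∀ k → cut (part lam 0) k ≡ part lam k
    cut-λ₁ k = m≤n⇒m⊓n≡m (antitone (part lam) lamP z≤n)
    dominated : ∀ t → Σ< t (part mu) ≤ Σ< t (cut (part lam 0))
    dominated t with t ≤? r
    ... | yes t≤r = subst (Σ< t (part mu) ≤_) (Σ<-cong t (λ k _ → sym (cut-λ₁ k))) (dominance t t≤r)
    ... | no  t≰r = ≤-reflexive (begin
      Σ< t (part mu)             ≡⟨ Σ<-vanishing-tail r t (part mu) r≤t (part-beyond mu) ⟩
      Σ< r (part mu)             ≡⟨ sym total ⟩
      Σ< r (part lam)            ≡⟨ sym (Σ<-vanishing-tail r t (part lam) r≤t (part-beyond lam)) ⟩
      Σ< t (part lam)            ≡⟨ Σ<-cong t (λ k _ → sym (cut-λ₁ k)) ⟩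
      Σ< t (cut (part lam 0))    ∎)
      where
      open ≡-Reasoning
      r≤t = <⇒≤ (≰⇒> t≰r)
    μ₁≤λ₁ : part mu 0 ≤ part lam 0
    μ₁≤λ₁ with 0 <? r
    ... | yes 0<r = subst (part mu 0 ≤_) (cut-λ₁ 0) (dominated 1)
    ... | no  0≮r rewrite part-beyond mu 0 (≮⇒≥ 0≮r) = z≤n
    leftJustified : ∀ i c → c < part lam 0 → initMat r mu i c ≡ (c <ᵇ part mu i)
    leftJustified i c _ with i <? r
    ... | yes i<r rewrite <⇒<ᵇ≡true i<r = refl
    ... | no  i≮r rewrite ≥⇒<ᵇ≡false {i} {r} (≮⇒≥ i≮r) | part-beyond mu i (≮⇒≥ i≮r) = refl

lemma2p9 : (r : ℕ) (lam mu : Vec ℕ r) → Kostka r lam mu →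
    (∀ c → c < width lam →
      Type1 (column r (canonical r lam mu) c) ⊎
      Type2 (column r (canonical r lam mu) c) ⊎
      Type3 (column r (canonical r lam mu) c))
    × (0 < width lam → Type1 (column r (canonical r lam mu) 0))
lemma2p9 r lam mu kostka@(lamP , _) =
  run-columnTypes (width lam) (initMat r mu) ≤-refl (initialInvariant mu kostka)
  where open Canonical r lam lamP
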